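{- For every $k\ge 2$, $\mathrm{CPDL}^+(\mathrm{TW}_k)<\mathrm{CPDL}^+(\mathrm{TW}_{k+1})$. Furthermore, $\mathrm{CPDL}^+(\mathrm{TW}_k)<_{\mathbb K}\mathrm{CPDL}^+(\mathrm{TW}_{k+1})$.
   Context: Fix a countably infinite set $\sigma$ of relation names, each $R\in\sigma$ with an arity $\mathrm{ar}(R)\ge 1$; unary names are atomic propositions, binary names are atomic programs; $\mathrm{Vars}$ is a countably infinite set of variables. A $\sigma$-structure $K$ has a domain $\mathrm{dom}(K)$ (worlds) and relations $R^K\subseteq\mathrm{dom}(K)^{\mathrm{ar}(R)}$; $K$ is a Kripke structure if $R^K=\emptyset$ for all $R$ of arity $>2$. Graphs are finite undirected graphs whose edges are sets of one or two vertices; $\mathrm{TW}_k$ is the class of graphs of tree-width at most $k$. CPDL: formulas $\varphi::=p\mid\neg\varphi\mid\varphi\wedge\varphi\mid\langle\pi\rangle$, programs $\pi::=\varepsilon\mid a\mid\bar a\mid\pi\cup\pi\mid\pi\circ\pi\mid\pi^*\mid\varphi?$, with the standard semantics: $[\![p]\!]_K=p^K$, $\neg$ complement, $\wedge$ intersection, $[\![\langle\pi\rangle]\!]=\{u:\exists v\,(u,v)\in[\![\pi]\!]\}$, $\varepsilon$ identity, $[\![a]\!]=a^K$, $\bar a$ converse of $a^K$, $\cup$ union, $\circ$ composition, ${}^*$ reflexive-transitive closure, $[\![\varphi?]\!]=\{(u,u):u\in[\![\varphi]\!]\}$. $\mathrm{CPDL}^+$ adds conjunctive programs $C[x_s,x_t]$: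 $C$ is a finite set of atoms, each a p-atom $\pi(x,x')$ ($\pi$ a $\mathrm{CPDL}^+$ program, $x,x'$ variables) or an r-atom $R(x_1,\dots,x_n)$ with $\mathrm{ar}(R)=n>2$; $x_s,x_t\in\mathrm{Vars}(C)$ (possibly equal); the graph $G_C$ on $\mathrm{Vars}(C)$ with an edge $\{u,v\}$ (possibly $u=v$) whenever $u,v$ occur in a common atom is connected. $[\![C[x_s,x_t]]\!]_K$ is the set of pairs $(f(x_s),f(x_t))$ for maps $f:\mathrm{Vars}(C)\to\mathrm{dom}(K)$ with $(f(x),f(x'))\in[\![\pi]\!]_K$ for each p-atom $\pi(x,x')$ and $f(\bar x)\in R^K$ for each r-atom $R(\bar x)$. The underlying graph of $C[x_s,x_t]$ is $G_C$ plus the edge $\{x_s,x_t\}$; $\mathrm{CPDL}^+(\mathcal G)$ is the fragment in which every conjunctive program occurring has underlying graph in $\mathcal G$. For logics $L_1,L_2$ with formulas and programs: $L_1\le L_2$ means there is a translation mapping $L_1$-formulas to $L_2$-formulas and $L_1$-programs to $L_2$-programs with the same semantics on every $\sigma$-structure; $L_1<L_2$ means $L_1\le L_2$ and not $L_2\le L_1$. The relations $\le_{\mathbb K}$, $<_{\mathbb K}$ are defined the same way but requiring semantic equality only on Kripke structures. -}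

module Defs where

open import Data.Nat using (ℕ; zero; suc; _≤_; _+_)
open import Data.Fin using (Fin; zero; suc; toℕ)
open import Data.List using (List; []; _∷_; _++_; length)
open import Data.List.Membership.Propositional using (_∈_)
open import Data.List.Relation.Unary.Unique.Propositional using (Unique)
open import Data.Vec using (Vec; toList)
open import Data.Product using (Σ; ∃; _×_; _,_)
open import Data.Sum using (_⊎_)
open import Relation.Nullary using (¬_)
open import Relation.Binary.PropositionalEquality using (_≡_)
open import Relation.Binary.Construct.Closure.ReflexiveTransitive using (Star)
open import Function.Bundles using (_⇔_)

-- Relation names are pairs (n , i) : ℕ × ℕ, the name
-- (n , i) having arity suc n (so every arity ≥ 1 has countably many
-- names).  Unary names (0 , i) are the atomic propositions p_i, binary
-- names (1 , i) the atomic programs a_i.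

Var : Set
Var = ℕ

record Structure : Set₁ where
  field
    D   : Set
    rel : (n i : ℕ) → Vec D (suc n) → Set
open Structure public

IsKripke : Structure → Set
IsKripke K = ∀ n i (v : Vec (D K) (suc n)) → 2 ≤ n → ¬ rel K n i v

-- Syntax of CPDL⁺ (raw; well-formedness of conjunctive programs is
-- imposed by the fragment predicates below)

mutual
  data Form : Set where
    prop : ℕ → Form
    ¬f   : Form → Form
    _∧f_ : Form → Form → Form
    ⟨_⟩  : Prog → Form

  data Prog : Set where
    ε     : Prog
    atom  : ℕ → Prog
    conv  : ℕ → Prog
    _∪p_  : Prog → Prog → Prog
    _∘p_  : Prog → Prog → Prog
    _*    : Prog → Prog
    _??   : Form → Prog
    conj  : List Atom → Var → Var → Prog

  data Atom : Set where
    patom : Prog → Var → Var → Atom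
    -- r-atom R(x_1 … x_{n+3}) with R the name (n + 2 , i) of arity n + 3 > 2
    ratom : (n i : ℕ) → Vec Var (suc (suc (suc n))) → Atom

module _ (K : Structure) where
  mutual
    ⟦_⟧f : Form → D K → Set
    ⟦ prop i ⟧f u = rel K 0 i (u Data.Vec.∷ Data.Vec.[])
    ⟦ ¬f φ ⟧f u = ¬ ⟦ φ ⟧f u
    ⟦ φ ∧f ψ ⟧f u = ⟦ φ ⟧f u × ⟦ ψ ⟧f u
    ⟦ ⟨ π ⟩ ⟧f u = ∃ λ v → ⟦ π ⟧p u v

    ⟦_⟧p : Prog → D K → D K → Set
    ⟦ ε ⟧p u v = u ≡ v
    ⟦ atom i ⟧p u v = rel K 1 i (u Data.Vec.∷ v Data.Vec.∷ Data.Vec.[])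
    ⟦ conv i ⟧p u v = rel K 1 i (v Data.Vec.∷ u Data.Vec.∷ Data.Vec.[])
    ⟦ π ∪p ρ ⟧p u v = ⟦ π ⟧p u v ⊎ ⟦ ρ ⟧p u v
    ⟦ π ∘p ρ ⟧p u v = ∃ λ w → ⟦ π ⟧p u w × ⟦ ρ ⟧p w v
    ⟦ π * ⟧p u v = Star (λ a b → ⟦ π ⟧p a b) u v
    ⟦ φ ?? ⟧p u v = u ≡ v × ⟦ φ ⟧f u
    ⟦ conj C xs xt ⟧p u v =
      ∃ λ (f : Var → D K) → holds C f × f xs ≡ u × f xt ≡ v

    holds : List Atom → (Var → D K) → Set
    holds [] f = Data.Unit.⊤
      where import Data.Unit
    holds (patom π x y ∷ C) f = ⟦ π ⟧p (f x) (f y) × holds C f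
    holds (ratom n i xs ∷ C) f =
      rel K (suc (suc n)) i (Data.Vec.map f xs) × holds C f

-- Graphs (finite; vertex list, edges = symmetric relation, loops allowed)

record Graph : Set₁ where
  field
    V : List ℕ
    E : ℕ → ℕ → Set
open Graph public

-- A (finite) tree on the nodes Fin (suc m), rooted at 0, given by parent
-- pointers: node suc j has parent par j, whose index is ≤ j.
record Tree : Set where
  field
    m      : ℕ
    par    : Fin m → Fin (suc m)
    par-lt : ∀ j → toℕ (par j) ≤ toℕ j
open Tree public

Node : Tree → Set
Node T = Fin (suc (m T))

Adj : (T : Tree) → Node T → Node T → Set
Adj T s t = ∃ λ j → (s ≡ suc j × t ≡ par T j) ⊎ (t ≡ suc j × s ≡ par T j)

record TreeDecomposition (k : ℕ) (G : Graph) : Set₁ where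
  field
    tree    : Tree
    bag     : Node tree → List ℕ
    bag-uniq : ∀ t → Unique (bag t)
    bag-sub : ∀ t x → x ∈ bag t → x ∈ V G
    width   : ∀ t → length (bag t) ≤ suc k
    vcover  : ∀ x → x ∈ V G → ∃ λ t → x ∈ bag t
    ecover  : ∀ x y → E G x y → ∃ λ t → x ∈ bag t × y ∈ bag t
    connected : ∀ x s t → x ∈ bag s → x ∈ bag t →
      Star (λ a b → Adj tree a b × x ∈ bag a × x ∈ bag b) s t

TW : ℕ → Graph → Set₁
TW k G = TreeDecomposition k G

atomVars : Atom → List Var
atomVars (patom π x y) = x ∷ y ∷ []
atomVars (ratom n i xs) = toList xs

Vars : List Atom → List Var
Vars [] = []
Vars (a ∷ C) = atomVars a ++ Vars C

GC : List Atom → Graph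
GC C = record
  { V = Vars C
  ; E = λ x y → ∃ λ a → a ∈ C × x ∈ atomVars a × y ∈ atomVars a }

ConnectedGraph : Graph → Set
ConnectedGraph G = ∀ x y → x ∈ V G → y ∈ V G → Star (E G) x y

Underlying : List Atom → Var → Var → Graph
Underlying C xs xt = record
  { V = Vars C
  ; E = λ x y → E (GC C) x y ⊎ (x ≡ xs × y ≡ xt) ⊎ (x ≡ xt × y ≡ xs) }

data Lift (A : Set) : Set₁ where
  lift : A → Lift A

Lift⊤ : Set₁
Lift⊤ = Lift Data.Unit.⊤
  where import Data.Unit

GraphClass : Set₂
GraphClass = Graph → Set₁

module _ (𝒢 : GraphClass) where
  mutual
    InF : Form → Set₁
    InF (prop i) = Lift⊤
    InF (¬f φ) = InF φ
    InF (φ ∧f ψ) = InF φ × InF ψ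
    InF ⟨ π ⟩ = InP π

    InP : Prog → Set₁
    InP ε = Lift⊤
    InP (atom i) = Lift⊤
    InP (conv i) = Lift⊤
    InP (π ∪p ρ) = InP π × InP ρ
    InP (π ∘p ρ) = InP π × InP ρ
    InP (π *) = InP π
    InP (φ ??) = InF φ
    InP (conj C xs xt) =
      InAtoms C × Lift (xs ∈ Vars C × xt ∈ Vars C × ConnectedGraph (GC C))
                × 𝒢 (Underlying C xs xt)

    InAtoms : List Atom → Set₁
    InAtoms [] = Lift⊤
    InAtoms (patom π x y ∷ C) = InP π × InAtoms C
    InAtoms (ratom n i xs ∷ C) = InAtoms C

record Logic : Set₂ where
  field
    IsForm : Form → Set₁
    IsProg : Prog → Set₁
open Logic public

CPDL⁺ : GraphClass → Logic
CPDL⁺ 𝒢 = record { IsForm = InF 𝒢 ; IsProg = InP 𝒢 }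

_≤[_]_ : Logic → (Structure → Set) → Logic → Set₁
L₁ ≤[ Cls ] L₂ =
  Σ (Σ Form (IsForm L₁) → Σ Form (IsForm L₂)) λ tf →
  Σ (Σ Prog (IsProg L₁) → Σ Prog (IsProg L₂)) λ tp →
    ∀ (K : Structure) → Cls K →
      (∀ φ u → ⟦ K ⟧f (Data.Product.proj₁ (tf φ)) u ⇔ ⟦ K ⟧f (Data.Product.proj₁ φ) u)
    × (∀ π u v → ⟦ K ⟧p (Data.Product.proj₁ (tp π)) u v ⇔ ⟦ K ⟧p (Data.Product.proj₁ π) u v)

_<[_]_ : Logic → (Structure → Set) → Logic → Set₁
L₁ <[ Cls ] L₂ = (L₁ ≤[ Cls ] L₂) × ¬ (L₂ ≤[ Cls ] L₁)

AllStructures : Structure → Set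
AllStructures K = Data.Unit.⊤
  where import Data.Unit

_≤L_ _<L_ _≤𝕂_ _<𝕂_ : Logic → Logic → Set₁
L₁ ≤L L₂ = L₁ ≤[ AllStructures ] L₂
L₁ <L L₂ = L₁ <[ AllStructures ] L₂
L₁ ≤𝕂 L₂ = L₁ ≤[ IsKripke ] L₂
L₁ <𝕂 L₂ = L₁ <[ IsKripke ] L₂

{-# OPTIONS --safe #-}
-- Let Kₙ be the structure on Fin n in which atomic program 0 is ≠ and all other relations are
-- empty. For n, m > k, a CPDL⁺(TW k) program relates u, v in Kₙ iff it relates u′, v′ in Kₘ,
-- whenever u = v ⇔ u′ = v′. For a conjunctive program, a witnessing assignment into Kₙ is
-- recoloured with m colours bag by bag along a tree decomposition of width k, keeping the
-- equality type on every bag, and then permuted so that the endpoints go to u′, v′; composition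
-- and star only need a third colour, which is where k ≥ 2 is used. So no CPDL⁺(TW k) formula
-- tells K_{k+1} from K_{k+2}, while the (k+2)-clique query, of tree-width k + 1, holds in K_{k+2}
-- but not in K_{k+1}.
module Submission where

open import Defs
open import Data.Nat as ℕ using (ℕ; zero; suc; _≤_; _<_; _+_; z≤n; s≤s)
open import Data.Empty using (⊥; ⊥-elim)
open import Data.Fin using (Fin; zero; suc; toℕ; fromℕ<)
open import Data.Fin.Permutation using (Permutation′; _⟨$⟩ʳ_; transpose; _∘ₚ_)
import Data.Fin.Permutation.Components as PC
import Data.Fin.Properties as Finₚ
open import Data.List using (List; []; _∷_; _++_; length; lookup; map; concatMap; upTo; filter)
open import Data.List.Membership.Propositional using (_∈_; _∉_; lose; find)
open import Data.List.Membership.Propositional.Properties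
  using ( ∈-++⁺ˡ; ∈-++⁺ʳ; ∈-++⁻; ∈-map⁺; ∈-map⁻; ∈-upTo⁺; ∈-upTo⁻; ∈-filter⁺; ∈-filter⁻
        ; ∈-concatMap⁺; ∈-concatMap⁻)
open import Data.List.Membership.DecPropositional ℕ._≟_ using (_∈?_)
open import Data.List.Properties using (length-++; length-map; length-upTo)
open import Data.List.Relation.Unary.Any as Any using (here; there; any?)
open import Data.List.Relation.Unary.Any.Properties using (lookup-index)
open import Data.List.Relation.Unary.Unique.Propositional.Properties using (upTo⁺)
open import Data.Nat.DivMod using (_mod_; m<n⇒m%n≡m)
import Data.Nat.Properties as ℕₚ
open import Data.Product using (Σ; ∃; _×_; _,_; proj₁; proj₂)
open import Data.Sum using (_⊎_; inj₁; inj₂)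
open import Data.Unit using (tt)
open import Data.Vec using (Vec; []; _∷_)
open import Level using (0ℓ)
open import Function using (_∘_)
open import Function.Bundles using (_⇔_; mk⇔; Equivalence; Injection)
open import Function.Properties.Inverse using (↔⇒↣)
import Function.Properties.Equivalence as ⇔
open import Relation.Binary using (DecidableEquality; tri<; tri≈; tri>)
open import Relation.Binary.Construct.Closure.ReflexiveTransitive using (Star; ε; _◅_)
open import Relation.Binary.PropositionalEquality
open import Relation.Nullary using (¬_; yes; no)
open import Relation.Nullary.Decidable using (dec-true; dec-false)
open import Relation.Unary using (Pred; Decidable; ∅)
open import Relation.Unary.Properties using (∁?; ∅?)

open Equivalence using (to; from)

∃-∉ : ∀ {m} (cs : List (Fin m)) → length cs < m → ∃ λ c → c ∉ cs
∃-∉ {m} cs len = Finₚ.¬∀⟶∃¬ m (_∈ cs) (λ c → any? (c Finₚ.≟_) cs) all-used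
  where
  all-used : ¬ (∀ c → c ∈ cs)
  all-used c∈cs with i , j , i<j , same ← Finₚ.pigeonhole len (Any.index ∘ c∈cs) =
    ℕₚ.<-irrefl (cong toℕ i≡j) i<j
    where
    i≡j : i ≡ j
    i≡j = trans (lookup-index (c∈cs i)) (trans (cong (lookup cs) same) (sym (lookup-index (c∈cs j))))

transpose-ˡ : ∀ {m} (i j : Fin m) → PC.transpose i j i ≡ j
transpose-ˡ i j rewrite dec-true (i Finₚ.≟ i) refl = refl

transpose-≢ : ∀ {m} {i j k : Fin m} → k ≢ i → k ≢ j → PC.transpose i j k ≡ k
transpose-≢ {i = i} {j} {k} k≢i k≢j
  rewrite dec-false (k Finₚ.≟ i) k≢i | dec-false (k Finₚ.≟ j) k≢j = refl

permutation-sending : ∀ {m} (a b u v : Fin m) → (a ≡ b) ⇔ (u ≡ v) →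
  ∃ λ (π : Permutation′ m) → π ⟨$⟩ʳ a ≡ u × π ⟨$⟩ʳ b ≡ v
permutation-sending a b u v a≡b⇔u≡v with a Finₚ.≟ b
... | yes refl = transpose a u , transpose-ˡ a u , trans (transpose-ˡ a u) (to a≡b⇔u≡v refl)
... | no a≢b =
  transpose a u ∘ₚ transpose b′ v ,
  trans (cong (PC.transpose b′ v) (transpose-ˡ a u)) (transpose-≢ u≢b′ u≢v) ,
  transpose-ˡ b′ v
  where
  b′ : Fin _
  b′ = PC.transpose a u b
  u≢v : u ≢ v
  u≢v = a≢b ∘ from a≡b⇔u≡v
  u≢b′ : u ≢ b′
  u≢b′ u≡b′ = a≢b (Injection.injective (↔⇒↣ (transpose a u)) (trans (transpose-ˡ a u) u≡b′))

≡⇔≡-permute : ∀ {m} (π : Permutation′ m) {a b : Fin m} → (a ≡ b) ⇔ (π ⟨$⟩ʳ a ≡ π ⟨$⟩ʳ b)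
≡⇔≡-permute π = mk⇔ (cong (π ⟨$⟩ʳ_)) (Injection.injective (↔⇒↣ π))

≡⇔≡-refl : ∀ {A B : Set} {u : A} {u′ : B} → (u ≡ u) ⇔ (u′ ≡ u′)
≡⇔≡-refl = mk⇔ (λ _ → refl) (λ _ → refl)

≡⇔≡-sym : ∀ {A B : Set} {u v : A} {u′ v′ : B} → (u ≡ v) ⇔ (u′ ≡ v′) → (v ≡ u) ⇔ (v′ ≡ u′)
≡⇔≡-sym e = mk⇔ (sym ∘ to e ∘ sym) (sym ∘ from e ∘ sym)

≡⇔≡-through : ∀ {n m} → 3 ≤ m → {u v : Fin n} {u′ v′ : Fin m} → (u ≡ v) ⇔ (u′ ≡ v′) →
  ∀ w → ∃ λ w′ → ((u ≡ w) ⇔ (u′ ≡ w′)) × ((w ≡ v) ⇔ (w′ ≡ v′))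
≡⇔≡-through 3≤m {u} {v} {u′} {v′} u≡v⇔ w with w Finₚ.≟ u | w Finₚ.≟ v
... | yes refl | _ = u′ , ≡⇔≡-refl , u≡v⇔
... | no _ | yes refl = v′ , u≡v⇔ , ≡⇔≡-refl
... | no w≢u | no w≢v with w′ , w′∉ ← ∃-∉ (u′ ∷ v′ ∷ []) 3≤m =
  w′ , mk⇔ (⊥-elim ∘ w≢u ∘ sym) (λ u′≡w′ → ⊥-elim (w′∉ (here (sym u′≡w′))))
     , mk⇔ (⊥-elim ∘ w≢v) (λ w′≡v′ → ⊥-elim (w′∉ (there (here w′≡v′))))

_[_↦_] : ∀ {B : Set} → (ℕ → B) → ℕ → B → ℕ → B
(g [ x ↦ c ]) z with z ℕ.≟ x
... | yes _ = c
... | no _ = g z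

[↦]-≡ : ∀ {B : Set} (g : ℕ → B) x c → (g [ x ↦ c ]) x ≡ c
[↦]-≡ g x c with x ℕ.≟ x
... | yes _ = refl
... | no x≢x = ⊥-elim (x≢x refl)

[↦]-≢ : ∀ {B : Set} (g : ℕ → B) {x} c {z} → z ≢ x → (g [ x ↦ c ]) z ≡ g z
[↦]-≢ g {x} c {z} z≢x with z ℕ.≟ x
... | yes z≡x = ⊥-elim (z≢x z≡x)
... | no _ = refl

length-filter-∁+filter : ∀ {A : Set} {P : Pred A 0ℓ} (P? : Decidable P) xs →
  length (filter (∁? P?) xs) + length (filter P? xs) ≡ length xs
length-filter-∁+filter P? [] = refl
length-filter-∁+filter P? (x ∷ xs) with P? x
... | yes _ = trans (ℕₚ.+-suc _ _) (cong suc (length-filter-∁+filter P? xs))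
... | no _ = cong suc (length-filter-∁+filter P? xs)

module Recolouring {A : Set} (_≟ᴬ_ : DecidableEquality A) (f : ℕ → A) {m : ℕ} where

  Agree : (ℕ → Fin m) → ℕ → ℕ → Set
  Agree g x y = (f x ≡ f y) ⇔ (g x ≡ g y)

  AgreeOn : Pred ℕ 0ℓ → (ℕ → Fin m) → Set
  AgreeOn S g = ∀ {x y} → S x → S y → Agree g x y

  AgreeOn-cong : ∀ {S g h} → (∀ {z} → S z → h z ≡ g z) → AgreeOn S g → AgreeOn S h
  AgreeOn-cong h≗g agree {x} {y} Sx Sy rewrite h≗g Sx | h≗g Sy = agree Sx Sy

  -- x reuses the colour of a variable of S with the same f-value if there is one, and takes a
  -- colour unused on S otherwise.
  extend-one : (S : List ℕ) → length S < m → (g : ℕ → Fin m) → AgreeOn (_∈ S) g →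
    ∀ x → ∃ λ c → AgreeOn (_∈ x ∷ S) (g [ x ↦ c ])
  extend-one S len g agree x = c , agree′
    where
    fitting : ∃ λ c → ∀ {b} → b ∈ S → (f x ≡ f b) ⇔ (c ≡ g b)
    fitting with any? (λ z → f z ≟ᴬ f x) S
    ... | yes match with z , z∈S , fz≡fx ← find match =
      g z , λ b∈S → mk⇔ (to (agree z∈S b∈S) ∘ trans fz≡fx) (trans (sym fz≡fx) ∘ from (agree z∈S b∈S))
    ... | no no-match with c , c∉ ← ∃-∉ (map g S) (subst (_< m) (sym (length-map g S)) len) =
      c , λ b∈S → mk⇔ (λ fx≡fb → ⊥-elim (no-match (lose b∈S (sym fx≡fb))))
                      (λ c≡gb → ⊥-elim (c∉ (subst (_∈ map g S) (sym c≡gb) (∈-map⁺ g b∈S))))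

    c : Fin m
    c = proj₁ fitting

    split : ∀ {a} → a ∈ x ∷ S → a ≡ x ⊎ (a ≢ x × a ∈ S)
    split {a} a∈ with a ℕ.≟ x | a∈
    ... | yes a≡x | _ = inj₁ a≡x
    ... | no a≢x | here a≡x = ⊥-elim (a≢x a≡x)
    ... | no a≢x | there a∈S = inj₂ (a≢x , a∈S)

    agree′ : AgreeOn (_∈ x ∷ S) (g [ x ↦ c ])
    agree′ {a} {b} a∈ b∈ with split a∈ | split b∈
    ... | inj₁ refl | inj₁ refl = ≡⇔≡-refl
    ... | inj₁ refl | inj₂ (b≢x , b∈S)
      rewrite [↦]-≡ g x c | [↦]-≢ g c b≢x = proj₂ fitting b∈S
    ... | inj₂ (a≢x , a∈S) | inj₁ refl
      rewrite [↦]-≡ g x c | [↦]-≢ g c a≢x = ≡⇔≡-sym (proj₂ fitting a∈S)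
    ... | inj₂ (a≢x , a∈S) | inj₂ (b≢x , b∈S)
      rewrite [↦]-≢ g c a≢x | [↦]-≢ g c b≢x = agree a∈S b∈S

  extend-many : (S todo : List ℕ) → length todo + length S ≤ m → (g : ℕ → Fin m) → AgreeOn (_∈ S) g →
    ∃ λ h → (∀ z → z ∉ todo → h z ≡ g z) × AgreeOn (_∈ todo ++ S) h
  extend-many S [] _ g agree = g , (λ _ _ → refl) , agree
  extend-many S (x ∷ todo) len g agree
    with h , h≗g , agree′ ← extend-many S todo (ℕₚ.<⇒≤ len) g agree
    with c , agree″ ← extend-one (todo ++ S) (subst (_< m) (sym (length-++ todo)) len) h agree′ x =
    h [ x ↦ c ] ,
    (λ z z∉ → trans ([↦]-≢ h c (z∉ ∘ here)) (h≗g z (z∉ ∘ there))) ,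
    agree″

  recolour : (P : Pred ℕ 0ℓ) → Decidable P → (L : List ℕ) → length L ≤ m → (g : ℕ → Fin m) →
    AgreeOn (λ z → z ∈ L × P z) g →
    ∃ λ h → (∀ z → P z ⊎ z ∉ L → h z ≡ g z) × AgreeOn (_∈ L) h
  recolour P P? L len g agree
    with h , h≗g , agree′ ← extend-many (filter P? L) (filter (∁? P?) L)
                              (ℕₚ.≤-trans (ℕₚ.≤-reflexive (length-filter-∁+filter P? L)) len) g
                              (λ x∈ y∈ → agree (∈-filter⁻ P? x∈) (∈-filter⁻ P? y∈)) =
    h , kept , λ x∈L y∈L → agree′ (covered x∈L) (covered y∈L)
    where
    covered : ∀ {z} → z ∈ L → z ∈ filter (∁? P?) L ++ filter P? L
    covered {z} z∈L with P? z
    ... | yes Pz = ∈-++⁺ʳ _ (∈-filter⁺ P? z∈L Pz)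
    ... | no ¬Pz = ∈-++⁺ˡ (∈-filter⁺ (∁? P?) z∈L ¬Pz)

    kept : ∀ z → P z ⊎ z ∉ L → h z ≡ g z
    kept z (inj₁ Pz) = h≗g z (λ z∈ → proj₂ (∈-filter⁻ (∁? P?) {xs = L} z∈) Pz)
    kept z (inj₂ z∉L) = h≗g z (z∉L ∘ proj₁ ∘ ∈-filter⁻ (∁? P?) {xs = L})

data Descendant (T : Tree) (t : Node T) : Node T → Set where
  here  : Descendant T t t
  child : ∀ i → Descendant T t (par T i) → Descendant T t (suc i)

descendant-≥ : ∀ {T t a} → Descendant T t a → toℕ t ≤ toℕ a
descendant-≥ here = ℕₚ.≤-refl
descendant-≥ {T} (child i d) = ℕₚ.≤-trans (descendant-≥ d) (ℕₚ.≤-trans (par-lt T i) (ℕₚ.n≤1+n _))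

module _ {k : ℕ} {G : Graph} (td : TreeDecomposition k G) where
  open TreeDecomposition td

  ∈-parent-or-descendant : ∀ {x a j} → Star (λ a b → Adj tree a b × x ∈ bag a × x ∈ bag b) a (suc j) →
    x ∈ bag (par tree j) ⊎ Descendant tree (suc j) a
  ∈-parent-or-descendant ε = inj₂ here
  ∈-parent-or-descendant ((adj , x∈a , _) ◅ path) with ∈-parent-or-descendant path
  ... | inj₁ x∈parent = inj₁ x∈parent
  ... | inj₂ b-below with adj
  ...   | i , inj₁ (refl , refl) = inj₂ (child i b-below)
  ...   | i , inj₂ (refl , refl) with b-below
  ...     | here = inj₁ x∈a
  ...     | child .i a-below = inj₂ a-below

  ∈-earlier-bag⇒∈-parent : ∀ {x s j} → x ∈ bag s → x ∈ bag (suc j) → toℕ s ≤ toℕ j →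
    x ∈ bag (par tree j)
  ∈-earlier-bag⇒∈-parent x∈s x∈j s≤j with ∈-parent-or-descendant (connected _ _ _ x∈s x∈j)
  ... | inj₁ x∈parent = x∈parent
  ... | inj₂ s-below = ⊥-elim (ℕₚ.<-irrefl refl (ℕₚ.≤-trans (s≤s s≤j) (descendant-≥ s-below)))

  -- Bags are coloured in index order. A parent has a smaller index than its child, and by
  -- ∈-earlier-bag⇒∈-parent the only vertices of a new bag coloured before are those it shares
  -- with its parent.
  module _ {A : Set} (_≟ᴬ_ : DecidableEquality A) (f : ℕ → A) {m : ℕ} (k<m : k < m) where
    open Recolouring _≟ᴬ_ f {m}

    private
      M : ℕ
      M = Tree.m tree

      fits : ∀ t → length (bag t) ≤ m
      fits t = ℕₚ.≤-trans (width t) k<m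

      colour-upto : ∀ t → t ≤ M → ∃ λ g → ∀ s → toℕ s ≤ t → AgreeOn (_∈ bag s) g
      colour-upto zero _
        with g , _ , agree ← recolour ∅ ∅? (bag zero) (fits zero)
                                (λ _ → fromℕ< (ℕₚ.≤-<-trans z≤n k<m)) (λ ()) =
        g , λ { zero _ → agree }
      colour-upto (suc t) t<M with g , agree ← colour-upto t (ℕₚ.<⇒≤ t<M) =
        h , agree′
        where
        j : Fin M
        j = fromℕ< t<M
        j≡t : toℕ j ≡ t
        j≡t = Finₚ.toℕ-fromℕ< t<M
        parent : Node tree
        parent = par tree j
        new : ∃ λ h → (∀ z → z ∈ bag parent ⊎ z ∉ bag (suc j) → h z ≡ g z)
                    × AgreeOn (_∈ bag (suc j)) h
        new = recolour (_∈ bag parent) (_∈? bag parent) (bag (suc j)) (fits (suc j)) g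
                (λ (_ , x∈p) (_ , y∈p) → agree parent parent≤t x∈p y∈p)
          where
          parent≤t : toℕ parent ≤ t
          parent≤t = ℕₚ.≤-trans (par-lt tree j) (ℕₚ.≤-reflexive j≡t)
        h : ℕ → Fin m
        h = proj₁ new
        h≗g : ∀ {s} → toℕ s ≤ t → ∀ {x} → x ∈ bag s → h x ≡ g x
        h≗g {s} s≤t {x} x∈s with x ∈? bag (suc j)
        ... | yes x∈j =
          proj₁ (proj₂ new) x (inj₁ (∈-earlier-bag⇒∈-parent x∈s x∈j (subst (toℕ s ≤_) (sym j≡t) s≤t)))
        ... | no x∉j = proj₁ (proj₂ new) x (inj₂ x∉j)
        agree′ : ∀ s → toℕ s ≤ suc t → AgreeOn (_∈ bag s) h
        agree′ s s≤1+t with ℕₚ.m≤n⇒m<n∨m≡n s≤1+t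
        ... | inj₁ (s≤s s≤t) = AgreeOn-cong (h≗g s≤t) (agree s s≤t)
        ... | inj₂ s≡1+t
          with refl ← Finₚ.toℕ-injective {i = s} {j = suc j} (trans s≡1+t (cong suc (sym j≡t))) =
          proj₂ (proj₂ new)

    tree-colouring : ∃ λ (g : ℕ → Fin m) → ∀ {x y} → E G x y → Agree g x y
    tree-colouring with g , agree ← colour-upto M ℕₚ.≤-refl = g , agree-on-edges
      where
      agree-on-edges : ∀ {x y} → E G x y → Agree g x y
      agree-on-edges xy with t , x∈t , y∈t ← ecover _ _ xy = agree t (ℕₚ.≤-pred (Finₚ.toℕ<n t)) x∈t y∈t

complete : ℕ → Structure
complete n = record { D = Fin n ; rel = distinct }
  where
  distinct : (a i : ℕ) → Vec (Fin n) (suc a) → Set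
  distinct 1 0 (u ∷ v ∷ []) = u ≢ v
  distinct _ _ _ = ⊥

complete-isKripke : ∀ n → IsKripke (complete n)
complete-isKripke n (suc (suc _)) _ _ _ ()
complete-isKripke n 1 _ _ (s≤s ())

module Transfer (k : ℕ) (2≤k : 2 ≤ k) where

  private
    3≤ : ∀ {m} → k < m → 3 ≤ m
    3≤ k<m = ℕₚ.≤-trans (s≤s 2≤k) k<m

  mutual
    transferF : ∀ {n m} → k < n → k < m → ∀ φ → InF (TW k) φ →
      ∀ u u′ → ⟦ complete n ⟧f φ u → ⟦ complete m ⟧f φ u′
    transferF k<n k<m (prop i) _ u u′ ()
    transferF k<n k<m (¬f φ) inφ u u′ ¬φ φ′ = ¬φ (transferF k<m k<n φ inφ u′ u φ′)
    transferF k<n k<m (φ ∧f ψ) (inφ , inψ) u u′ (φu , ψu) =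
      transferF k<n k<m φ inφ u u′ φu , transferF k<n k<m ψ inψ u u′ ψu
    transferF k<n k<m ⟨ π ⟩ inπ u u′ (v , πuv)
      with v′ , u≡v⇔ , _ ← ≡⇔≡-through (3≤ k<m) {u = u} {u′ = u′} ≡⇔≡-refl v =
      v′ , transferP k<n k<m π inπ u≡v⇔ πuv

    transferP : ∀ {n m} → k < n → k < m → ∀ π → InP (TW k) π →
      ∀ {u v u′ v′} → (u ≡ v) ⇔ (u′ ≡ v′) → ⟦ complete n ⟧p π u v → ⟦ complete m ⟧p π u′ v′
    transferP k<n k<m ε _ u≡v⇔ u≡v = to u≡v⇔ u≡v
    transferP k<n k<m (atom zero) _ u≡v⇔ u≢v = u≢v ∘ from u≡v⇔
    transferP k<n k<m (atom (suc _)) _ _ ()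
    transferP k<n k<m (conv zero) _ u≡v⇔ v≢u = v≢u ∘ from (≡⇔≡-sym u≡v⇔)
    transferP k<n k<m (conv (suc _)) _ _ ()
    transferP k<n k<m (π ∪p ρ) (inπ , _) u≡v⇔ (inj₁ πuv) = inj₁ (transferP k<n k<m π inπ u≡v⇔ πuv)
    transferP k<n k<m (π ∪p ρ) (_ , inρ) u≡v⇔ (inj₂ ρuv) = inj₂ (transferP k<n k<m ρ inρ u≡v⇔ ρuv)
    transferP k<n k<m (π ∘p ρ) (inπ , inρ) u≡v⇔ (w , πuw , ρwv)
      with w′ , u≡w⇔ , w≡v⇔ ← ≡⇔≡-through (3≤ k<m) u≡v⇔ w =
      w′ , transferP k<n k<m π inπ u≡w⇔ πuw , transferP k<n k<m ρ inρ w≡v⇔ ρwv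
    transferP k<n k<m (π *) inπ u≡v⇔ π*uv = transferStar k<n k<m π inπ u≡v⇔ π*uv
    transferP k<n k<m (φ ??) inφ u≡v⇔ (refl , φu) = to u≡v⇔ refl , transferF k<n k<m φ inφ _ _ φu
    transferP k<n k<m (conj C xs xt) (inC , _ , td) {u′ = u′} {v′} u≡v⇔ (f , Cf , refl , refl)
      with g , agree ← tree-colouring td Finₚ._≟_ f k<m
      with σ , σxs , σxt ← permutation-sending (g xs) (g xt) u′ v′
                             (⇔.trans (⇔.sym (agree (inj₂ (inj₁ (refl , refl))))) u≡v⇔) =
      (λ x → σ ⟨$⟩ʳ g x) , transferAtoms k<n k<m C inC f _ agree′ Cf , σxs , σxt
      where
      agree′ : ∀ {π x y} → patom π x y ∈ C → (f x ≡ f y) ⇔ (σ ⟨$⟩ʳ g x ≡ σ ⟨$⟩ʳ g y)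
      agree′ a∈C = ⇔.trans (agree (inj₁ (_ , a∈C , here refl , there (here refl)))) (≡⇔≡-permute σ)

    transferStar : ∀ {n m} → k < n → k < m → ∀ π → InP (TW k) π →
      ∀ {u v u′ v′} → (u ≡ v) ⇔ (u′ ≡ v′) →
      Star (⟦ complete n ⟧p π) u v → Star (⟦ complete m ⟧p π) u′ v′
    transferStar k<n k<m π inπ {u′ = u′} u≡v⇔ ε = subst (Star _ u′) (to u≡v⇔ refl) ε
    transferStar k<n k<m π inπ u≡v⇔ (_◅_ {j = w} πuw π*wv)
      with w′ , u≡w⇔ , w≡v⇔ ← ≡⇔≡-through (3≤ k<m) u≡v⇔ w =
      transferP k<n k<m π inπ u≡w⇔ πuw ◅ transferStar k<n k<m π inπ w≡v⇔ π*wv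

    transferAtoms : ∀ {n m} → k < n → k < m → ∀ C → InAtoms (TW k) C →
      (f : ℕ → Fin n) (g : ℕ → Fin m) →
      (∀ {π x y} → patom π x y ∈ C → (f x ≡ f y) ⇔ (g x ≡ g y)) →
      holds (complete n) C f → holds (complete m) C g
    transferAtoms k<n k<m [] _ f g _ _ = tt
    transferAtoms k<n k<m (patom π x y ∷ C) (inπ , inC) f g agree (πxy , Cf) =
      transferP k<n k<m π inπ (agree (here refl)) πxy ,
      transferAtoms k<n k<m C inC f g (agree ∘ there) Cf
    transferAtoms k<n k<m (ratom _ _ _ ∷ C) _ f g _ (() , _)

∈-Vars⁺ : ∀ {C a x} → a ∈ C → x ∈ atomVars a → x ∈ Vars C
∈-Vars⁺ {a ∷ _} (here refl) x∈a = ∈-++⁺ˡ x∈a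
∈-Vars⁺ {a ∷ _} (there a∈C) x∈a = ∈-++⁺ʳ (atomVars a) (∈-Vars⁺ a∈C x∈a)

∈-Vars⁻ : ∀ {C x} → x ∈ Vars C → ∃ λ a → a ∈ C × x ∈ atomVars a
∈-Vars⁻ {a ∷ C} x∈ with ∈-++⁻ (atomVars a) x∈
... | inj₁ x∈a = a , here refl , x∈a
... | inj₂ x∈C with b , b∈C , x∈b ← ∈-Vars⁻ {C} x∈C = b , there b∈C , x∈b

holds-∈ : ∀ K {C f π x y} → holds K C f → patom π x y ∈ C → ⟦ K ⟧p π (f x) (f y)
holds-∈ K {patom _ _ _ ∷ _} (πxy , _) (here refl) = πxy
holds-∈ K {patom _ _ _ ∷ _} (_ , Cf) (there a∈C) = holds-∈ K Cf a∈C
holds-∈ K {ratom _ _ _ ∷ _} (_ , Cf) (there a∈C) = holds-∈ K Cf a∈C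

edge : ℕ × ℕ → Atom
edge (i , j) = patom (atom 0) i j

holds-edges : ∀ K f ps → (∀ {i j} → (i , j) ∈ ps → ⟦ K ⟧p (atom 0) (f i) (f j)) → holds K (map edge ps) f
holds-edges K f [] _ = tt
holds-edges K f (_ ∷ ps) related = related (here refl) , holds-edges K f ps (related ∘ there)

InAtoms-edges : ∀ 𝒢 ps → InAtoms 𝒢 (map edge ps)
InAtoms-edges 𝒢 [] = lift tt
InAtoms-edges 𝒢 (_ ∷ ps) = lift tt , InAtoms-edges 𝒢 ps

pairs< : ℕ → List (ℕ × ℕ)
pairs< N = concatMap (λ j → map (_, j) (upTo j)) (upTo N)

∈-pairs<⁺ : ∀ {i j N} → i < j → j < N → (i , j) ∈ pairs< N
∈-pairs<⁺ i<j j<N = ∈-concatMap⁺ _ (lose (∈-upTo⁺ j<N) (∈-map⁺ _ (∈-upTo⁺ i<j)))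

∈-pairs<⁻ : ∀ {i j N} → (i , j) ∈ pairs< N → i < j × j < N
∈-pairs<⁻ p∈ with j′ , j∈ , p∈row ← find (∈-concatMap⁻ _ p∈)
  with _ , i∈ , refl ← ∈-map⁻ (_, j′) p∈row =
  ∈-upTo⁻ i∈ , ∈-upTo⁻ j∈

cliqueQuery : ℕ → List Atom
cliqueQuery N = map edge (pairs< N)

Vars-cliqueQuery⁻ : ∀ {N x} → x ∈ Vars (cliqueQuery N) → x < N
Vars-cliqueQuery⁻ {N} x∈ with _ , a∈ , x∈a ← ∈-Vars⁻ {cliqueQuery N} x∈
  with _ , p∈ , refl ← ∈-map⁻ edge a∈
  with i<j , j<N ← ∈-pairs<⁻ {N = N} p∈ | x∈a
... | here refl = ℕₚ.<-trans i<j j<N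
... | there (here refl) = j<N

Vars-cliqueQuery⁺ : ∀ {N x} → 2 ≤ N → x < N → x ∈ Vars (cliqueQuery N)
Vars-cliqueQuery⁺ {N} {zero} 2≤N _ =
  ∈-Vars⁺ {cliqueQuery N} (∈-map⁺ edge (∈-pairs<⁺ (s≤s z≤n) 2≤N)) (here refl)
Vars-cliqueQuery⁺ {N} {suc _} _ x<N =
  ∈-Vars⁺ {cliqueQuery N} (∈-map⁺ edge (∈-pairs<⁺ (s≤s z≤n) x<N)) (there (here refl))

cliqueQuery-connected : ∀ N → ConnectedGraph (GC (cliqueQuery N))
cliqueQuery-connected N x y x∈ y∈ with ℕₚ.<-cmp x y
... | tri< x<y _ _ =
  (edge (x , y) , ∈-map⁺ edge (∈-pairs<⁺ x<y (Vars-cliqueQuery⁻ {N} y∈)) , here refl , there (here refl)) ◅ ε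
... | tri≈ _ refl _ = ε
... | tri> _ _ y<x =
  (edge (y , x) , ∈-map⁺ edge (∈-pairs<⁺ y<x (Vars-cliqueQuery⁻ {N} x∈)) , there (here refl) , here refl) ◅ ε

cliqueQuery-treeDecomposition : ∀ {k} → TW (suc k) (Underlying (cliqueQuery (2 + k)) 0 0)
cliqueQuery-treeDecomposition {k} = record
  { tree = record { m = 0 ; par = λ () ; par-lt = λ () }
  ; bag = λ _ → upTo N
  ; bag-uniq = λ _ → upTo⁺ N
  ; bag-sub = λ _ _ x∈ → Vars-cliqueQuery⁺ (s≤s (s≤s z≤n)) (∈-upTo⁻ x∈)
  ; width = λ _ → ℕₚ.≤-reflexive (length-upTo N)
  ; vcover = λ _ x∈ → zero , ∈-upTo⁺ (Vars-cliqueQuery⁻ {N} x∈)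
  ; ecover = λ x y xy → zero , ∈-upTo⁺ (proj₁ (ends< xy)) , ∈-upTo⁺ (proj₂ (ends< xy))
  ; connected = λ { _ zero zero _ _ → ε }
  }
  where
  N : ℕ
  N = 2 + k
  ends< : ∀ {x y} → E (Underlying (cliqueQuery N) 0 0) x y → x < N × y < N
  ends< (inj₁ (_ , a∈ , x∈a , y∈a)) =
    Vars-cliqueQuery⁻ {N} (∈-Vars⁺ {cliqueQuery N} a∈ x∈a) ,
    Vars-cliqueQuery⁻ {N} (∈-Vars⁺ {cliqueQuery N} a∈ y∈a)
  ends< (inj₂ (inj₁ (refl , refl))) = s≤s z≤n , s≤s z≤n
  ends< (inj₂ (inj₂ (refl , refl))) = s≤s z≤n , s≤s z≤n

mod-injective : ∀ {i j N} .{{_ : ℕ.NonZero N}} → i < N → j < N → i mod N ≡ j mod N → i ≡ j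
mod-injective {i} {j} {N} i<N j<N i≡j = begin
  i             ≡⟨ sym (m<n⇒m%n≡m i<N) ⟩
  i ℕ.% N       ≡⟨ sym (Finₚ.toℕ-fromℕ< _) ⟩
  toℕ (i mod N) ≡⟨ cong toℕ i≡j ⟩
  toℕ (j mod N) ≡⟨ Finₚ.toℕ-fromℕ< _ ⟩
  j ℕ.% N       ≡⟨ m<n⇒m%n≡m j<N ⟩
  j             ∎
  where open ≡-Reasoning

module Separation (k : ℕ) (2≤k : 2 ≤ k) where

  N : ℕ
  N = 2 + k

  φ : Form
  φ = ⟨ conj (cliqueQuery N) 0 0 ⟩

  φ-inTW : InF (TW (suc k)) φ
  φ-inTW = InAtoms-edges _ (pairs< N) ,
           lift (0∈ , 0∈ , cliqueQuery-connected N) ,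
           cliqueQuery-treeDecomposition
    where
    0∈ : 0 ∈ Vars (cliqueQuery N)
    0∈ = Vars-cliqueQuery⁺ {N} (s≤s (s≤s z≤n)) (s≤s z≤n)

  φ-holds : ⟦ complete N ⟧f φ zero
  φ-holds = zero , (_mod N) , holds-edges (complete N) (_mod N) (pairs< N) distinct , refl , refl
    where
    distinct : ∀ {i j} → (i , j) ∈ pairs< N → i mod N ≢ j mod N
    distinct p∈ with i<j , j<N ← ∈-pairs<⁻ p∈ =
      ℕₚ.<⇒≢ i<j ∘ mod-injective (ℕₚ.<-trans i<j j<N) j<N

  φ-fails : ¬ ⟦ complete (suc k) ⟧f φ zero
  φ-fails (_ , g , Cg , _) with i , j , i<j , gi≡gj ← Finₚ.pigeonhole ℕₚ.≤-refl (g ∘ toℕ {N}) =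
    holds-∈ (complete (suc k)) Cg (∈-map⁺ edge (∈-pairs<⁺ i<j (Finₚ.toℕ<n j))) gi≡gj

  not-≤𝕂 : ¬ (CPDL⁺ (TW (suc k)) ≤𝕂 CPDL⁺ (TW k))
  not-≤𝕂 (translate , _ , sound) =
    φ-fails (to (ψ⇔φ k) (transferF (ℕₚ.n≤1+n (suc k)) ℕₚ.≤-refl (proj₁ ψ) (proj₂ ψ) zero zero
                                   (from (ψ⇔φ (suc k)) φ-holds)))
    where
    open Transfer k 2≤k
    ψ : Σ Form (InF (TW k))
    ψ = translate (φ , φ-inTW)
    ψ⇔φ : ∀ n → ⟦ complete (suc n) ⟧f (proj₁ ψ) zero ⇔ ⟦ complete (suc n) ⟧f φ zero
    ψ⇔φ n = proj₁ (sound (complete (suc n)) (complete-isKripke (suc n))) (φ , φ-inTW) zero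

TW-mono : ∀ {k G} → TW k G → TW (suc k) G
TW-mono td = record
  { tree = tree ; bag = bag ; bag-uniq = bag-uniq ; bag-sub = bag-sub
  ; width = λ t → ℕₚ.m≤n⇒m≤1+n (width t)
  ; vcover = vcover ; ecover = ecover ; connected = connected }
  where open TreeDecomposition td

module _ {𝒢 ℋ : GraphClass} (𝒢⊆ℋ : ∀ {G} → 𝒢 G → ℋ G) where

  mutual
    InF-mono : ∀ φ → InF 𝒢 φ → InF ℋ φ
    InF-mono (prop _) in𝒢 = in𝒢
    InF-mono (¬f φ) in𝒢 = InF-mono φ in𝒢
    InF-mono (φ ∧f ψ) (inφ , inψ) = InF-mono φ inφ , InF-mono ψ inψ
    InF-mono ⟨ π ⟩ in𝒢 = InP-mono π in𝒢

    InP-mono : ∀ π → InP 𝒢 π → InP ℋ π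
    InP-mono ε in𝒢 = in𝒢
    InP-mono (atom _) in𝒢 = in𝒢
    InP-mono (conv _) in𝒢 = in𝒢
    InP-mono (π ∪p ρ) (inπ , inρ) = InP-mono π inπ , InP-mono ρ inρ
    InP-mono (π ∘p ρ) (inπ , inρ) = InP-mono π inπ , InP-mono ρ inρ
    InP-mono (π *) in𝒢 = InP-mono π in𝒢
    InP-mono (φ ??) in𝒢 = InF-mono φ in𝒢
    InP-mono (conj C _ _) (inC , wellFormed , G∈𝒢) = InAtoms-mono C inC , wellFormed , 𝒢⊆ℋ G∈𝒢

    InAtoms-mono : ∀ C → InAtoms 𝒢 C → InAtoms ℋ C
    InAtoms-mono [] in𝒢 = in𝒢
    InAtoms-mono (patom π _ _ ∷ C) (inπ , inC) = InP-mono π inπ , InAtoms-mono C inC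
    InAtoms-mono (ratom _ _ _ ∷ C) inC = InAtoms-mono C inC

  CPDL⁺-mono : ∀ Cls → CPDL⁺ 𝒢 ≤[ Cls ] CPDL⁺ ℋ
  CPDL⁺-mono Cls =
    (λ (φ , inφ) → φ , InF-mono φ inφ) ,
    (λ (π , inπ) → π , InP-mono π inπ) ,
    λ _ _ → (λ _ _ → ⇔.refl) , (λ _ _ _ → ⇔.refl)

≤-restrict : ∀ {L₁ L₂ Cls Cls′} → (∀ K → Cls′ K → Cls K) → L₁ ≤[ Cls ] L₂ → L₁ ≤[ Cls′ ] L₂
≤-restrict Cls′⊆Cls (tf , tp , sound) = tf , tp , λ K K∈Cls′ → sound K (Cls′⊆Cls K K∈Cls′)

mainTheorem2 : ∀ (k : ℕ) → 2 ≤ k →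
    (CPDL⁺ (TW k) <L CPDL⁺ (TW (suc k))) × (CPDL⁺ (TW k) <𝕂 CPDL⁺ (TW (suc k)))
mainTheorem2 k 2≤k =
  (CPDL⁺-mono TW-mono AllStructures , not-≤𝕂 ∘ ≤-restrict (λ _ _ → tt)) ,
  (CPDL⁺-mono TW-mono IsKripke , not-≤𝕂)
  where open Separation k 2≤k
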